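{- Let $\mathcal{P}=(G,(D,\sqcap),\delta)$ be a pattern structure such that $(D,\sqcap)$ is a complete semilattice. Then: (1) for any projection (kernel operator) $\psi$ of $D$ we have $\mathbb{R}(\psi(\mathcal{P})) \leq_S \mathbb{R}(\mathcal{P})$; (2) for any formal context $\mathbb{K}=(G,M,I)$ such that $\mathbb{K} \leq_S \mathbb{R}(\mathcal{P})$, there is a projection $\psi$ of $D$ such that $\mathbb{K}$ is a representation context of $\psi(\mathcal{P})$.
   Context: A pattern structure $\mathcal{P}=(G,(D,\sqcap),\delta)$ consists of a set of objects $G$, a meet-semilattice $(D,\sqcap)$ of descriptions with natural order $c\sqsubseteq d \Leftrightarrow c\sqcap d=c$, and a map $\delta: G\to D$ such that $\delta(G)$ generates a complete subsemilattice $(D_\delta,\sqcap)$ of $(D,\sqcap)$, where $D_\delta$ is the set of all meets $\mathop{\sqcap}_{g\in X}\delta(g)$ for $X\subseteq G$. Its Galois connection is $A^\diamond=\mathop{\sqcap}_{g\in A}\delta(g)$ for $A\subseteq G$ and $d^\diamond=\{g\in G \mid d\sqsubseteq \delta(g)\}$ for $d\in D$; pattern extents are sets $A$ with $A^{\diamond\diamond}=A$. The join on $D_\delta$ is $\bigsqcup X = \mathop{\sqcap}\{d\in D_\delta \mid (\forall x\in X)\, x\sqsubseteq d\}$. A set $M\subseteq D$ is $\sqcup$-dense for $D_\delta$ if every element of $D_\delta$ is $\bigsqcup X$ for some $X\subseteq M$; for such $M$, the formal context $(G,M,I)$ with $(g,m)\in I \Leftrightarrow m\sqsubseteq\delta(g)$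 is a representation context of $\mathcal{P}$, denoted $\mathbb{R}(\mathcal{P})$. A projection $\psi: D\to D$ is a kernel operator (monotone, contractive $\psi(x)\sqsubseteq x$, idempotent). The o-projected pattern structure is $\psi(\mathcal{P})=(G,(\psi(D),\sqcap_\psi),\psi\circ\delta)$ where $\psi(D)=\{d\in D\mid \psi(d)=d\}$ and $x\sqcap_\psi y := \psi(x\sqcap y)$. For formal contexts $\mathbb{K}_1=(G,M_1,I_1)$ and $\mathbb{K}_2=(G,M_2,I_2)$ on the same object set, $\mathbb{K}_1 \leq_S \mathbb{K}_2$ ("$\mathbb{K}_1$ is simpler than $\mathbb{K}_2$") means that for every $m\in M_1$ there is a set $B\subseteq M_2$ with $\{m\}^{1}=B^{2}$, where $(\cdot)^1,(\cdot)^2$ are the derivation operators of $\mathbb{K}_1,\mathbb{K}_2$. Contexts are considered up to attribute reduction (attribute-reduced contexts). -}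

module Defs where

open import Level using (Level; _⊔_; 0ℓ; Setω) renaming (suc to lsuc)
open import Relation.Binary.PropositionalEquality using (_≡_)
open import Data.Product using (Σ; _×_; _,_)
open import Data.Unit using (⊤)
open import Function using (id; _∘_)
open import Function.Bundles using (_⇔_)

-- Equality is propositional
-- equality on the carrier; the natural order is c ⊑ d ⇔ c ⊓ d ≡ c.

record CompleteSemilattice : Setω where
  field
    Carrier  : Set
    _⊓_      : Carrier → Carrier → Carrier
    ⊓-idem   : ∀ x → x ⊓ x ≡ x
    ⊓-comm   : ∀ x y → x ⊓ y ≡ y ⊓ x
    ⊓-assoc  : ∀ x y z → (x ⊓ y) ⊓ z ≡ x ⊓ (y ⊓ z)
    ⨅        : ∀ {ℓ} → (Carrier → Set ℓ) → Carrier
    ⨅-lower  : ∀ {ℓ} (X : Carrier → Set ℓ) x → X x → ⨅ X ⊓ x ≡ ⨅ X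
    ⨅-greatest : ∀ {ℓ} (X : Carrier → Set ℓ) y →
                 (∀ x → X x → y ⊓ x ≡ y) → y ⊓ ⨅ X ≡ y

record Context (G : Set) : Set₁ where
  field
    Attr : Set
    I    : G → Attr → Set

_≤S_ : {G : Set} → Context G → Context G → Set₁
_≤S_ {G} K₁ K₂ =
  ∀ (m : Context.Attr K₁) →
    Σ (Context.Attr K₂ → Set) λ B →
      ∀ (g : G) → Context.I K₁ g m ⇔ (∀ b → B b → Context.I K₂ g b)

module _ (L : CompleteSemilattice) where
  open CompleteSemilattice L

  _⊑_ : Carrier → Carrier → Set
  x ⊑ y = x ⊓ y ≡ x

  IsKernelOperator : (Carrier → Carrier) → Set
  IsKernelOperator ψ =
    (∀ x y → x ⊑ y → ψ x ⊑ ψ y) ×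
    (∀ x → ψ x ⊑ x) ×
    (∀ x → ψ (ψ x) ≡ ψ x)

  -- Generic notions for a pattern structure (G, (E, ⊓E), δ) whose
  -- description semilattice E is a subset U of D with meet ⊓E and complete
  -- meets ⨅E.
  module Generic (G : Set)
                 (U : Carrier → Set)
                 (_⊓E_ : Carrier → Carrier → Carrier)
                 (⨅E : ∀ {ℓ} → (Carrier → Set ℓ) → Carrier)
                 (δ : G → Carrier) where

    _⊑E_ : Carrier → Carrier → Set
    x ⊑E y = x ⊓E y ≡ x

    meetδ : (G → Set) → Carrier
    meetδ X = ⨅E (λ d → Σ G λ g → X g × δ g ≡ d)

    InDδ : Carrier → Set₁
    InDδ d = Σ (G → Set) λ X → meetδ X ≡ d

    ⨆ : (Carrier → Set) → Carrier
    ⨆ X = ⨅E (λ d → InDδ d × (∀ x → X x → x ⊑E d))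

    Dense : (Carrier → Set) → Set₁
    Dense M =
      (∀ d → M d → U d) ×
      (∀ d → InDδ d → Σ (Carrier → Set) λ X → (∀ x → X x → M x) × ⨆ X ≡ d)

    RepContext : (Carrier → Set) → Context G
    RepContext M = record { Attr = Σ Carrier M ; I = λ g m → Σ.proj₁ m ⊑E δ g }

    -- K is a representation context: its attributes are labelled by
    -- descriptions f(m) ∈ E forming a ⊔-dense set, and the incidence of K is
    -- exactly f(m) ⊑ δ(g).
    IsRepContext : Context G → Set₁
    IsRepContext K =
      Σ (Context.Attr K → Carrier) λ f →
        Dense (λ d → Σ (Context.Attr K) λ m → f m ≡ d) ×
        (∀ g m → Context.I K g m ⇔ (f m ⊑E δ g))

  -- Pattern structure P = (G, (D, ⊓), δ)  (D complete, so δ(G) generates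
  -- a complete subsemilattice automatically).
  record PatternStructure : Set₁ where
    field
      G : Set
      δ : G → Carrier

  module OfP (P : PatternStructure) =
    Generic (PatternStructure.G P) (λ _ → ⊤) _⊓_ ⨅ (PatternStructure.δ P)

  module OfψP (P : PatternStructure) (ψ : Carrier → Carrier) =
    Generic (PatternStructure.G P) (λ d → ψ d ≡ d)
            (λ x y → ψ (x ⊓ y)) (λ X → ψ (⨅ X)) (ψ ∘ PatternStructure.δ P)

-- A kernel operator ψ changes the incidence of a ψ-fixed attribute m only through
-- the order: m ⊑ψ ψ(δ g) iff m ⊑ δ g.  So (1) every attribute extent of R(ψ(P)) is an
-- extent of P, and the extents of P are attribute extents of R(P) because a ⊔-dense
-- set detects the order of D_δ.  Conversely (2), if K ≤S R(P), each attribute m of K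
-- has an extent of P as its extent and is labelled by its intent f(m); the kernel
-- operator ψ(d) = ⋁{f(m) | f(m) ⊑ d} fixes every label, and the labels are ⊔-dense in
-- ψ(D_δ) since every element there is the join of the labels below it.
module Submission where

open import Defs hiding (_⊑_)
open import Data.Product using (Σ; _×_; _,_; proj₁; proj₂)
open import Relation.Binary.PropositionalEquality using (_≡_; refl; sym; trans; cong; subst; module ≡-Reasoning)
open import Function using (_∘_)
open import Function.Bundles using (_⇔_; mk⇔; Equivalence)
open import Function.Construct.Composition using (_⇔-∘_)
open import Function.Construct.Symmetry using (⇔-sym)

extentOf : {G : Set} (K : Context G) → (Context.Attr K → Set) → G → Set
extentOf K B g = ∀ m → B m → Context.I K g m

module Order (L : CompleteSemilattice) where
  open CompleteSemilattice L

  infix 4 _⊑_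
  _⊑_ : Carrier → Carrier → Set
  _⊑_ = Defs._⊑_ L

  ⊑-refl : ∀ {x} → x ⊑ x
  ⊑-refl {x} = ⊓-idem x

  ⊑-trans : ∀ {x y z} → x ⊑ y → y ⊑ z → x ⊑ z
  ⊑-trans {x} {y} {z} x⊑y y⊑z = begin
    x ⊓ z        ≡⟨ cong (_⊓ z) (sym x⊑y) ⟩
    (x ⊓ y) ⊓ z  ≡⟨ ⊓-assoc x y z ⟩
    x ⊓ (y ⊓ z)  ≡⟨ cong (x ⊓_) y⊑z ⟩
    x ⊓ y        ≡⟨ x⊑y ⟩
    x            ∎
    where open ≡-Reasoning

  ⊑-antisym : ∀ {x y} → x ⊑ y → y ⊑ x → x ≡ y
  ⊑-antisym {x} {y} x⊑y y⊑x = trans (sym x⊑y) (trans (⊓-comm x y) y⊑x)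

  x⊓y⊑y : ∀ x y → x ⊓ y ⊑ y
  x⊓y⊑y x y = trans (⊓-assoc x y y) (cong (x ⊓_) (⊓-idem y))

  join : (Carrier → Set) → Carrier
  join S = ⨅ (λ u → ∀ s → S s → s ⊑ u)

  join-upper : ∀ S {s} → S s → s ⊑ join S
  join-upper S {s} s∈S = ⨅-greatest _ s (λ u u≥S → u≥S s s∈S)

  join-least : ∀ S {u} → (∀ s → S s → s ⊑ u) → join S ⊑ u
  join-least S {u} u≥S = ⨅-lower _ u u≥S

  module _ (F : Carrier → Set) where

    interior : Carrier → Carrier
    interior d = join (λ x → F x × x ⊑ d)

    interior-fixes : ∀ {x} → F x → interior x ≡ x
    interior-fixes {x} x∈F =
      ⊑-antisym (join-least _ (λ _ → proj₂)) (join-upper _ (x∈F , ⊑-refl))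

    interior-isKernelOperator : IsKernelOperator L interior
    interior-isKernelOperator = monotone , contractive , idempotent
      where
      monotone : ∀ x y → x ⊑ y → interior x ⊑ interior y
      monotone x y x⊑y = join-least _ λ z (z∈F , z⊑x) → join-upper _ (z∈F , ⊑-trans z⊑x x⊑y)

      contractive : ∀ x → interior x ⊑ x
      contractive x = join-least _ (λ _ → proj₂)

      idempotent : ∀ x → interior (interior x) ≡ interior x
      idempotent x = ⊑-antisym (contractive (interior x))
        (join-least _ λ z (z∈F , z⊑x) → join-upper _ (z∈F , join-upper _ (z∈F , z⊑x)))

module Kernel (L : CompleteSemilattice) {ψ : CompleteSemilattice.Carrier L → CompleteSemilattice.Carrier L}
              (kernel : IsKernelOperator L ψ) where
  open CompleteSemilattice L
  open Order L

  private
    monotone = proj₁ kernel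
    contractive = proj₁ (proj₂ kernel)

  ⊑ψ⇒⊑ : ∀ {x y} → ψ (x ⊓ y) ≡ x → x ⊑ y
  ⊑ψ⇒⊑ {x} {y} x⊑ψy = ⊑-trans (subst (_⊑ x ⊓ y) x⊑ψy (contractive (x ⊓ y))) (x⊓y⊑y x y)

  fixed-⊑⇒⊑ψ : ∀ {x y} → ψ x ≡ x → x ⊑ y → ψ (x ⊓ y) ≡ x
  fixed-⊑⇒⊑ψ ψx≡x x⊑y = trans (cong ψ x⊑y) ψx≡x

  fixed-⊑ψ∘ψ⇔⊑ : ∀ {x y} → ψ x ≡ x → (ψ (x ⊓ ψ y) ≡ x) ⇔ (x ⊑ y)
  fixed-⊑ψ∘ψ⇔⊑ {x} {y} ψx≡x = mk⇔
    (λ x⊑ψψy → ⊑-trans (⊑ψ⇒⊑ x⊑ψψy) (contractive y))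
    (λ x⊑y → fixed-⊑⇒⊑ψ ψx≡x (subst (_⊑ ψ y) ψx≡x (monotone x y x⊑y)))

module OfPFacts (L : CompleteSemilattice) (P : PatternStructure L) where
  open CompleteSemilattice L
  open Order L
  open PatternStructure P
  open OfP L P

  meetδ-lower : ∀ {Y g} → Y g → meetδ Y ⊑ δ g
  meetδ-lower {g = g} g∈Y = ⨅-lower _ (δ g) (g , g∈Y , refl)

  meetδ-greatest : ∀ {Y d} → (∀ g → Y g → d ⊑ δ g) → d ⊑ meetδ Y
  meetδ-greatest {d = d} d⊑Y = ⨅-greatest _ d λ { _ (g , g∈Y , refl) → d⊑Y g g∈Y }

  δ∈Dδ : ∀ g → InDδ (δ g)
  δ∈Dδ g = (_≡ g) , ⊑-antisym (meetδ-lower refl) (meetδ-greatest λ { _ refl → ⊑-refl })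

  ⨆-upper : ∀ X {x} → X x → x ⊑ ⨆ X
  ⨆-upper X {x} x∈X = ⨅-greatest _ x (λ _ (_ , u≥X) → u≥X x x∈X)

  ⨆-least : ∀ X {d} → InDδ d → (∀ x → X x → x ⊑ d) → ⨆ X ⊑ d
  ⨆-least X {d} d∈Dδ d≥X = ⨅-lower _ d (d∈Dδ , d≥X)

  dense-⊑ : ∀ {M c e} → Dense M → InDδ c → InDδ e →
            (∀ b → M b → b ⊑ c → b ⊑ e) → c ⊑ e
  dense-⊑ (_ , dense) c∈Dδ e∈Dδ below-c⇒below-e
    with X , X⊆M , ⨆X≡c ← dense _ c∈Dδ =
    subst (_⊑ _) ⨆X≡c (⨆-least X e∈Dδ λ x x∈X →
      below-c⇒below-e x (X⊆M x x∈X) (subst (x ⊑_) ⨆X≡c (⨆-upper X x∈X)))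

  extent-isRepExtent : ∀ {M} → Dense M → ∀ d →
    Σ (Σ Carrier M → Set) λ B → ∀ g → (d ⊑ δ g) ⇔ extentOf (RepContext M) B g
  extent-isRepExtent {M} dense d = B , λ g → mk⇔
    (λ d⊑δg b b⊑c → ⊑-trans b⊑c (meetδ-lower d⊑δg))
    (λ g∈B′ → ⊑-trans (meetδ-greatest λ _ d⊑δh → d⊑δh)
      (dense-⊑ dense (_ , refl) (δ∈Dδ g) λ b b∈M b⊑c → g∈B′ (b , b∈M) b⊑c))
    where
    B : Σ Carrier M → Set
    B (b , _) = b ⊑ meetδ (λ h → d ⊑ δ h)

  repExtent-closed : ∀ {M} (B : Σ Carrier M → Set) {A : G → Set} →
    (∀ h → A h ⇔ extentOf (RepContext M) B h) → ∀ g → A g ⇔ (meetδ A ⊑ δ g)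
  repExtent-closed B A≡B′ g = mk⇔ meetδ-lower λ A◇⊑δg → Equivalence.from (A≡B′ g) λ b b∈B →
    ⊑-trans (meetδ-greatest λ h h∈A → Equivalence.to (A≡B′ h) h∈A b b∈B) A◇⊑δg

module OfψPFacts (L : CompleteSemilattice) (P : PatternStructure L)
                 {ψ : CompleteSemilattice.Carrier L → CompleteSemilattice.Carrier L}
                 (kernel : IsKernelOperator L ψ) where
  open CompleteSemilattice L
  open Order L
  open Kernel L kernel
  open OfψP L P ψ

  private
    monotone = proj₁ kernel
    contractive = proj₁ (proj₂ kernel)
    idempotent = proj₂ (proj₂ kernel)

  Dδ-fixed : ∀ {d} → InDδ d → ψ d ≡ d
  Dδ-fixed (Y , refl) = idempotent _

  ⨆-fixed : ∀ X {d} → (∀ x → X x → ψ x ≡ x) → InDδ d → join X ≡ d → ⨆ X ≡ d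
  ⨆-fixed X {d} X-fixed d∈Dδ join≡d = ⊑-antisym ⨆X⊑d d⊑⨆X
    where
    T : Carrier → Set₁
    T e = InDδ e × (∀ x → X x → ψ (x ⊓ e) ≡ x)

    ⨆X⊑d : ψ (⨅ T) ⊑ d
    ⨆X⊑d = ⊑-trans (contractive _) (⨅-lower T d (d∈Dδ , λ x x∈X →
      fixed-⊑⇒⊑ψ (X-fixed x x∈X) (subst (x ⊑_) join≡d (join-upper X x∈X))))

    d⊑⨆X : d ⊑ ψ (⨅ T)
    d⊑⨆X = subst (_⊑ ψ (⨅ T)) join≡d (join-least X λ x x∈X →
      subst (_⊑ ψ (⨅ T)) (X-fixed x x∈X)
        (monotone x _ (⨅-greatest T x λ e (_ , x⊑ψe) → ⊑ψ⇒⊑ (x⊑ψe x x∈X))))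

module _ (L : CompleteSemilattice) (P : PatternStructure L) where
  open CompleteSemilattice L
  open Order L
  open OfPFacts L P
  open PatternStructure P using (δ)

  projection-≤S : (ψ : Carrier → Carrier) → IsKernelOperator L ψ →
    (Mψ : Carrier → Set) → OfψP.Dense L P ψ Mψ →
    (MP : Carrier → Set) → OfP.Dense L P MP →
    OfψP.RepContext L P ψ Mψ ≤S OfP.RepContext L P MP
  projection-≤S ψ kernel Mψ (Mψ-fixed , _) MP denseP (m , m∈Mψ)
    with B , m◇≡B′ ← extent-isRepExtent denseP m =
    B , λ g → m◇≡B′ g ⇔-∘ Kernel.fixed-⊑ψ∘ψ⇔⊑ L kernel (Mψ-fixed m m∈Mψ)

  ≤S⇒projection : (MP : Carrier → Set) → OfP.Dense L P MP →
    (K : Context (PatternStructure.G P)) → K ≤S OfP.RepContext L P MP →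
    Σ (Carrier → Carrier) λ ψ → IsKernelOperator L ψ × OfψP.IsRepContext L P ψ K
  ≤S⇒projection MP denseP K K≤R =
    ψ , kernel , label , (labels-fixed , dense) , incidence
    where
    open Context K

    label : Attr → Carrier
    label m = OfP.meetδ L P (λ h → I h m)

    Label : Carrier → Set
    Label x = Σ Attr λ m → label m ≡ x

    ψ : Carrier → Carrier
    ψ = interior Label

    kernel : IsKernelOperator L ψ
    kernel = interior-isKernelOperator Label

    labels-fixed : ∀ x → Label x → ψ x ≡ x
    labels-fixed _ (m , refl) = interior-fixes Label (m , refl)

    dense : ∀ d → OfψP.InDδ L P ψ d → Σ (Carrier → Set) λ X →
            (∀ x → X x → Label x) × OfψP.⨆ L P ψ X ≡ d
    dense d d∈Dδ = _ , (λ _ → proj₁) ,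
      OfψPFacts.⨆-fixed L P kernel _ (λ x → labels-fixed x ∘ proj₁) d∈Dδ
        (OfψPFacts.Dδ-fixed L P kernel d∈Dδ)

    incidence : ∀ g m → I g m ⇔ (ψ (label m ⊓ ψ (δ g)) ≡ label m)
    incidence g m with B , m′≡B′ ← K≤R m =
      ⇔-sym (Kernel.fixed-⊑ψ∘ψ⇔⊑ L kernel (labels-fixed _ (m , refl)))
        ⇔-∘ repExtent-closed B m′≡B′ g

theorem5 : (L : CompleteSemilattice) (P : PatternStructure L) →
    ((ψ : CompleteSemilattice.Carrier L → CompleteSemilattice.Carrier L) → IsKernelOperator L ψ →
      (Mψ : CompleteSemilattice.Carrier L → Set) → OfψP.Dense L P ψ Mψ →
      (MP : CompleteSemilattice.Carrier L → Set) → OfP.Dense L P MP →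
      OfψP.RepContext L P ψ Mψ ≤S OfP.RepContext L P MP)
    ×
    ((MP : CompleteSemilattice.Carrier L → Set) → OfP.Dense L P MP →
      (K : Context (PatternStructure.G P)) → K ≤S OfP.RepContext L P MP →
      Σ (CompleteSemilattice.Carrier L → CompleteSemilattice.Carrier L) λ ψ →
        IsKernelOperator L ψ × OfψP.IsRepContext L P ψ K)
theorem5 L P = projection-≤S L P , ≤S⇒projection L P
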